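{- Every dense vertex $v$ has external degree $\bar d(v)\le\epsilon\Delta$.
   Context: $G=(V,E)$ is a finite simple graph with maximum degree $\Delta$ and $N(v)$ the neighborhood of $v$; $\epsilon\in[0,1]$. An edge $uv$ is a friend edge if $|N(u)\cap N(v)|\ge(1-\epsilon)\Delta$; a vertex is dense if it is incident to at least $(1-\epsilon)\Delta$ friend edges. The almost-cliques are the connected components of the graph whose vertex set is the set of dense vertices and whose edges are the friend edges with both endpoints dense. For a dense vertex $v$ in almost-clique $C_j$, the external degree $\bar d(v)$ is the number of dense neighbors of $v$ not in $C_j$.
   Formalization: The parameter $\epsilon$ takes only rational values in [0,1]. -}

module Defs where

open import Data.Nat using (ℕ; _⊔_)
open import Data.Bool using (Bool; true; false; _∧_; T)
open import Data.Bool.Properties using (T?)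
open import Data.Fin using (Fin)
open import Data.List using (List; foldr; map; filter; length; allFin)
open import Data.Integer using (+_)
open import Data.Rational using (ℚ; _/_; _≤_; _-_; _*_; 1ℚ; 0ℚ; _≤ᵇ_)
open import Data.Fin.Subset using (Subset; _∈_; ∣_∣)
open import Data.Product using (_×_)
open import Relation.Binary.PropositionalEquality using (_≡_)
open import Relation.Nullary using (¬_)
open import Relation.Binary.Construct.Closure.ReflexiveTransitive using (Star)

record Graph (n : ℕ) : Set where
  field
    adj    : Fin n → Fin n → Bool
    sym    : ∀ u v → adj u v ≡ adj v u
    irrefl : ∀ v → adj v v ≡ false
open Graph public

ℕ→ℚ : ℕ → ℚ
ℕ→ℚ k = + k / 1

countV : ∀ {n} → (Fin n → Bool) → ℕ
countV {n} p = length (filter (λ w → T? (p w)) (allFin n))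

module _ {n : ℕ} (G : Graph n) where

  deg : Fin n → ℕ
  deg v = countV (adj G v)

  maxDeg : ℕ
  maxDeg = foldr _⊔_ 0 (map deg (allFin n))

  commonNbrs : Fin n → Fin n → ℕ
  commonNbrs u v = countV (λ w → adj G u w ∧ adj G v w)

  module _ (ε : ℚ) where

    thr : ℚ
    thr = (1ℚ - ε) * ℕ→ℚ maxDeg

    friendᵇ : Fin n → Fin n → Bool
    friendᵇ u v = adj G u v ∧ (thr ≤ᵇ ℕ→ℚ (commonNbrs u v))

    denseᵇ : Fin n → Bool
    denseᵇ v = thr ≤ᵇ ℕ→ℚ (countV (friendᵇ v))

    Dense : Fin n → Set
    Dense v = T (denseᵇ v)

    HEdge : Fin n → Fin n → Set
    HEdge u w = T (denseᵇ u ∧ denseᵇ w ∧ friendᵇ u w)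

    -- SameAlmostClique v w : v is dense and w lies in the connected
    -- component of v in H (vertex set: dense vertices, edges: HEdge),
    -- i.e. w is reachable from v by a finite H-path (Star = refl.-trans. closure).
    SameAlmostClique : Fin n → Fin n → Set
    SameAlmostClique v w = Dense v × Star HEdge v w

    ExternalNbr : Fin n → Fin n → Set
    ExternalNbr v w = T (adj G v w) × Dense w × ¬ SameAlmostClique v w

    -- external degree d̄(v) ≤ εΔ, stated as: every set of external
    -- neighbours of v has cardinality ≤ εΔ (the set of all external
    -- neighbours is one such set, so this is |ext. nbrs| ≤ εΔ)
    ExtDegAtMost : Fin n → ℚ → Set
    ExtDegAtMost v b = (S : Subset n) → (∀ w → w ∈ S → ExternalNbr v w) → ℕ→ℚ ∣ S ∣ ≤ b

{-# OPTIONS --safe #-}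
-- A friend w of v that is itself
-- dense is joined to v by an edge of the almost-clique graph, so it lies in v's almost-clique;
-- hence S and the set of friend edges at v are disjoint sets of neighbours of v, and
-- |S| + #friends(v) ≤ deg v ≤ Δ. Density of v says #friends(v) ≥ (1 − ε)Δ, so |S| ≤ εΔ.
module Submission where

open import Defs
open import Data.Nat using (ℕ)
open import Data.Fin using (Fin)
open import Data.Rational using (ℚ; _≤_; _*_; 0ℚ; 1ℚ)

open import Data.Bool using (Bool; true; false; T)
open import Data.Bool.Properties using (T?; T-≡; T-∧)
open import Data.Fin using (zero; suc)
open import Data.Fin.Subset using (Subset; ∣_∣; _∈_; _⊆_; _∪_; _∩_; Empty)
open import Data.Fin.Subset.Properties
  using (p⊆q⇒∣p∣≤∣q∣; x∈p∪q⁻; x∈p∩q⁻; Empty-unique; ∣⊥∣≡0)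
open import Data.List using (List; length; foldr; filter)
import Data.List as List
open import Data.List.Membership.Propositional using () renaming (_∈_ to _∈ₗ_)
open import Data.List.Membership.Propositional.Properties using (∈-map⁺; ∈-allFin)
open import Data.List.Relation.Unary.Any using (here; there)
import Data.Nat as ℕ
import Data.Nat.Properties as ℕ
import Data.Integer as ℤ
import Data.Integer.Properties as ℤ
import Data.Integer.Solver
import Data.Rational as ℚ
import Data.Rational.Properties as ℚ
open import Data.Rational.Solver using (module +-*-Solver)
import Data.Rational.Unnormalised as ℚᵘ
import Data.Rational.Unnormalised.Properties as ℚᵘ
open import Data.Vec using ([]; _∷_; tabulate)
open import Data.Vec.Properties using (lookup⇒[]=; []=⇒lookup; lookup∘tabulate)
open import Data.Product using (_,_; proj₁)
open import Data.Sum using ([_,_])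
open import Function using (id; _∘_; Equivalence)
open import Relation.Binary.PropositionalEquality
  using (_≡_; refl; trans; cong; subst; module ≡-Reasoning)
open import Relation.Binary.Construct.Closure.ReflexiveTransitive using (return)
open import Relation.Nullary using (¬_)

private
  variable
    n : ℕ

∣p∪q∣+∣p∩q∣≡∣p∣+∣q∣ : (p q : Subset n) → ∣ p ∪ q ∣ ℕ.+ ∣ p ∩ q ∣ ≡ ∣ p ∣ ℕ.+ ∣ q ∣
∣p∪q∣+∣p∩q∣≡∣p∣+∣q∣ []          []          = refl
∣p∪q∣+∣p∩q∣≡∣p∣+∣q∣ (true  ∷ p) (true  ∷ q) = cong ℕ.suc (begin
  ∣ p ∪ q ∣ ℕ.+ ℕ.suc ∣ p ∩ q ∣    ≡⟨ ℕ.+-suc ∣ p ∪ q ∣ ∣ p ∩ q ∣ ⟩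
  ℕ.suc (∣ p ∪ q ∣ ℕ.+ ∣ p ∩ q ∣)  ≡⟨ cong ℕ.suc (∣p∪q∣+∣p∩q∣≡∣p∣+∣q∣ p q) ⟩
  ℕ.suc (∣ p ∣ ℕ.+ ∣ q ∣)          ≡⟨ ℕ.+-suc ∣ p ∣ ∣ q ∣ ⟨
  ∣ p ∣ ℕ.+ ℕ.suc ∣ q ∣            ∎)
  where open ≡-Reasoning
∣p∪q∣+∣p∩q∣≡∣p∣+∣q∣ (true  ∷ p) (false ∷ q) = cong ℕ.suc (∣p∪q∣+∣p∩q∣≡∣p∣+∣q∣ p q)
∣p∪q∣+∣p∩q∣≡∣p∣+∣q∣ (false ∷ p) (true  ∷ q) = begin
  ℕ.suc (∣ p ∪ q ∣ ℕ.+ ∣ p ∩ q ∣)  ≡⟨ cong ℕ.suc (∣p∪q∣+∣p∩q∣≡∣p∣+∣q∣ p q) ⟩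
  ℕ.suc (∣ p ∣ ℕ.+ ∣ q ∣)          ≡⟨ ℕ.+-suc ∣ p ∣ ∣ q ∣ ⟨
  ∣ p ∣ ℕ.+ ℕ.suc ∣ q ∣            ∎
  where open ≡-Reasoning
∣p∪q∣+∣p∩q∣≡∣p∣+∣q∣ (false ∷ p) (false ∷ q) = ∣p∪q∣+∣p∩q∣≡∣p∣+∣q∣ p q

Empty[p∩q]⇒∣p∣+∣q∣≤∣r∣ : {p q r : Subset n} → p ⊆ r → q ⊆ r → Empty (p ∩ q) →
                          ∣ p ∣ ℕ.+ ∣ q ∣ ℕ.≤ ∣ r ∣
Empty[p∩q]⇒∣p∣+∣q∣≤∣r∣ {n} {p} {q} {r} p⊆r q⊆r p∩q-empty = begin
  ∣ p ∣ ℕ.+ ∣ q ∣          ≡⟨ ∣p∪q∣+∣p∩q∣≡∣p∣+∣q∣ p q ⟨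
  ∣ p ∪ q ∣ ℕ.+ ∣ p ∩ q ∣  ≡⟨ cong (∣ p ∪ q ∣ ℕ.+_) ∣p∩q∣≡0 ⟩
  ∣ p ∪ q ∣ ℕ.+ 0          ≡⟨ ℕ.+-identityʳ ∣ p ∪ q ∣ ⟩
  ∣ p ∪ q ∣                ≤⟨ p⊆q⇒∣p∣≤∣q∣ (λ {x} → [ p⊆r , q⊆r ] ∘ x∈p∪q⁻ p q) ⟩
  ∣ r ∣                    ∎
  where
  open ℕ.≤-Reasoning
  ∣p∩q∣≡0 : ∣ p ∩ q ∣ ≡ 0
  ∣p∩q∣≡0 = trans (cong ∣_∣ (Empty-unique {p = p ∩ q} p∩q-empty)) (∣⊥∣≡0 n)

T⇒∈tabulate : {f : Fin n → Bool} {x : Fin n} → T (f x) → x ∈ tabulate f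
T⇒∈tabulate {f = f} {x} fx = lookup⇒[]= x (tabulate f)
  (trans (lookup∘tabulate f x) (Equivalence.to T-≡ fx))

∈tabulate⇒T : {f : Fin n → Bool} {x : Fin n} → x ∈ tabulate f → T (f x)
∈tabulate⇒T {f = f} {x} x∈f = Equivalence.from T-≡
  (subst (_≡ true) (lookup∘tabulate f x) ([]=⇒lookup x∈f))

length-filter-tabulate : {A : Set} (q : A → Bool) (f : Fin n → A) →
                         length (filter (T? ∘ q) (List.tabulate f)) ≡ ∣ tabulate (q ∘ f) ∣
length-filter-tabulate {ℕ.zero}  q f = refl
length-filter-tabulate {ℕ.suc n} q f with q (f zero)
... | true  = cong ℕ.suc (length-filter-tabulate q (f ∘ suc))
... | false = length-filter-tabulate q (f ∘ suc)

countV≡∣tabulate∣ : (p : Fin n → Bool) → countV p ≡ ∣ tabulate p ∣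
countV≡∣tabulate∣ p = length-filter-tabulate p id

∈⇒≤foldr-⊔ : {m : ℕ} {ms : List ℕ} → m ∈ₗ ms → m ℕ.≤ foldr ℕ._⊔_ 0 ms
∈⇒≤foldr-⊔ (here refl)  = ℕ.m≤m⊔n _ _
∈⇒≤foldr-⊔ (there m∈ms) = ℕ.≤-trans (∈⇒≤foldr-⊔ m∈ms) (ℕ.m≤n⊔m _ _)

deg≤maxDeg : (G : Graph n) (v : Fin n) → deg G v ℕ.≤ maxDeg G
deg≤maxDeg G v = ∈⇒≤foldr-⊔ (∈-map⁺ (deg G) (∈-allFin v))

-- ℕ→ℚ m is definitionally fromℚᵘ (mkℚᵘ (+ m) 0).
toℚᵘ-ℕ→ℚ : (m : ℕ) → ℚ.toℚᵘ (ℕ→ℚ m) ℚᵘ.≃ ℚᵘ.mkℚᵘ (ℤ.+ m) 0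
toℚᵘ-ℕ→ℚ m = ℚ.toℚᵘ-fromℚᵘ (ℚᵘ.mkℚᵘ (ℤ.+ m) 0)

ℕ→ℚ-mono-≤ : {m k : ℕ} → m ℕ.≤ k → ℕ→ℚ m ≤ ℕ→ℚ k
ℕ→ℚ-mono-≤ {m} {k} m≤k = ℚ.toℚᵘ-cancel-≤ (begin
  ℚ.toℚᵘ (ℕ→ℚ m)     ≃⟨ toℚᵘ-ℕ→ℚ m ⟩
  ℚᵘ.mkℚᵘ (ℤ.+ m) 0  ≤⟨ ℚᵘ.*≤* (ℤ.*-monoʳ-≤-nonNeg (ℤ.+ 1) (ℤ.+≤+ m≤k)) ⟩
  ℚᵘ.mkℚᵘ (ℤ.+ k) 0  ≃⟨ toℚᵘ-ℕ→ℚ k ⟨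
  ℚ.toℚᵘ (ℕ→ℚ k)     ∎)
  where open ℚᵘ.≤-Reasoning

mkℚᵘ-homo-+ : (i j : ℤ.ℤ) → ℚᵘ.mkℚᵘ i 0 ℚᵘ.+ ℚᵘ.mkℚᵘ j 0 ℚᵘ.≃ ℚᵘ.mkℚᵘ (i ℤ.+ j) 0
mkℚᵘ-homo-+ i j =
  ℚᵘ.*≡* (solve 2 (λ i j → (i :* one :+ j :* one) :* one := (i :+ j) :* one) refl i j)
  where
  open Data.Integer.Solver.+-*-Solver
  one = con ℤ.1ℤ

ℕ→ℚ-homo-+ : (m k : ℕ) → ℕ→ℚ (m ℕ.+ k) ≡ ℕ→ℚ m ℚ.+ ℕ→ℚ k
ℕ→ℚ-homo-+ m k = ℚ.toℚᵘ-injective (begin-equality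
  ℚ.toℚᵘ (ℕ→ℚ (m ℕ.+ k))                   ≃⟨ toℚᵘ-ℕ→ℚ (m ℕ.+ k) ⟩
  ℚᵘ.mkℚᵘ (ℤ.+ (m ℕ.+ k)) 0                 ≡⟨ cong (λ i → ℚᵘ.mkℚᵘ i 0) (ℤ.pos-+ m k) ⟩
  ℚᵘ.mkℚᵘ (ℤ.+ m ℤ.+ ℤ.+ k) 0               ≃⟨ mkℚᵘ-homo-+ (ℤ.+ m) (ℤ.+ k) ⟨
  ℚᵘ.mkℚᵘ (ℤ.+ m) 0 ℚᵘ.+ ℚᵘ.mkℚᵘ (ℤ.+ k) 0  ≃⟨ ℚᵘ.+-cong (toℚᵘ-ℕ→ℚ m) (toℚᵘ-ℕ→ℚ k) ⟨
  ℚ.toℚᵘ (ℕ→ℚ m) ℚᵘ.+ ℚ.toℚᵘ (ℕ→ℚ k)       ≃⟨ ℚ.toℚᵘ-homo-+ (ℕ→ℚ m) (ℕ→ℚ k) ⟨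
  ℚ.toℚᵘ (ℕ→ℚ m ℚ.+ ℕ→ℚ k)                 ∎)
  where open ℚᵘ.≤-Reasoning

p+q≤r⇒[1-s]*r≤q⇒p≤s*r : {p q r s : ℚ} → p ℚ.+ q ≤ r → (1ℚ ℚ.- s) * r ≤ q → p ≤ s * r
p+q≤r⇒[1-s]*r≤q⇒p≤s*r {p} {q} {r} {s} p+q≤r [1-s]*r≤q = begin
  p                     ≡⟨ solve 2 (λ p q → p := (p :+ q) :- q) refl p q ⟩
  (p ℚ.+ q) ℚ.- q       ≤⟨ ℚ.+-mono-≤ p+q≤r (ℚ.neg-antimono-≤ [1-s]*r≤q) ⟩
  r ℚ.- (1ℚ ℚ.- s) * r  ≡⟨ solve 2 (λ r s → r :- (con 1ℚ :- s) :* r := s :* r) refl r s ⟩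
  s * r                 ∎
  where
  open ℚ.≤-Reasoning
  open +-*-Solver

module _ {n : ℕ} (G : Graph n) (ε : ℚ) where

  neighbours : Fin n → Subset n
  neighbours v = tabulate (adj G v)

  friends : Fin n → Subset n
  friends v = tabulate (friendᵇ G ε v)

  friends⊆neighbours : {v : Fin n} → friends v ⊆ neighbours v
  friends⊆neighbours = T⇒∈tabulate ∘ proj₁ ∘ Equivalence.to T-∧ ∘ ∈tabulate⇒T

  friend⇒sameAlmostClique : {v w : Fin n} → Dense G ε v → Dense G ε w →
                            T (friendᵇ G ε v w) → SameAlmostClique G ε v w
  friend⇒sameAlmostClique dense-v dense-w v~w =
    dense-v , return (Equivalence.from T-∧ (dense-v , Equivalence.from T-∧ (dense-w , v~w)))

  externalNbr⇒¬friend : {v w : Fin n} → Dense G ε v → ExternalNbr G ε v w →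
                        ¬ T (friendᵇ G ε v w)
  externalNbr⇒¬friend dense-v (_ , dense-w , ¬same) =
    ¬same ∘ friend⇒sameAlmostClique dense-v dense-w

  externals+friends≤maxDeg : {v : Fin n} → Dense G ε v → (S : Subset n) →
                             (∀ w → w ∈ S → ExternalNbr G ε v w) →
                             ∣ S ∣ ℕ.+ countV (friendᵇ G ε v) ℕ.≤ maxDeg G
  externals+friends≤maxDeg {v} dense-v S S-external = begin
    ∣ S ∣ ℕ.+ countV (friendᵇ G ε v)  ≡⟨ cong (∣ S ∣ ℕ.+_) (countV≡∣tabulate∣ (friendᵇ G ε v)) ⟩
    ∣ S ∣ ℕ.+ ∣ friends v ∣           ≤⟨ Empty[p∩q]⇒∣p∣+∣q∣≤∣r∣ S⊆neighbours friends⊆neighbours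
                                                                 S∩friends-empty ⟩
    ∣ neighbours v ∣                  ≡⟨ countV≡∣tabulate∣ (adj G v) ⟨
    deg G v                           ≤⟨ deg≤maxDeg G v ⟩
    maxDeg G                          ∎
    where
    open ℕ.≤-Reasoning
    S⊆neighbours : S ⊆ neighbours v
    S⊆neighbours {w} w∈S = T⇒∈tabulate (proj₁ (S-external w w∈S))
    S∩friends-empty : Empty (S ∩ friends v)
    S∩friends-empty (w , w∈S∩friends) =
      let w∈S , w∈friends = x∈p∩q⁻ S (friends v) w∈S∩friends
      in  externalNbr⇒¬friend dense-v (S-external w w∈S) (∈tabulate⇒T w∈friends)

mainTheorem7 : {n : ℕ} (G : Graph n) (ε : ℚ) → 0ℚ ≤ ε → ε ≤ 1ℚ →
               (v : Fin n) → Dense G ε v →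
               ExtDegAtMost G ε v (ε * ℕ→ℚ (maxDeg G))
mainTheorem7 G ε _ _ v dense-v S S-external =
  p+q≤r⇒[1-s]*r≤q⇒p≤s*r {s = ε} externals+friends≤Δ (ℚ.≤ᵇ⇒≤ dense-v)
  where
  externals+friends≤Δ : ℕ→ℚ ∣ S ∣ ℚ.+ ℕ→ℚ (countV (friendᵇ G ε v)) ≤ ℕ→ℚ (maxDeg G)
  externals+friends≤Δ =
    subst (_≤ ℕ→ℚ (maxDeg G)) (ℕ→ℚ-homo-+ ∣ S ∣ (countV (friendᵇ G ε v)))
      (ℕ→ℚ-mono-≤ (externals+friends≤maxDeg G ε dense-v S S-external))
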